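{- Let $T$ be a semi-complete digraph with a feedback arc set $F$ of size at most $k$. Let $T'$ be the transitive tournament on $V(T)$ whose vertex ordering is any topological ordering of $T\setminus F$. Then every $k$-cut of $T$ is also a $2k$-cut of $T'$.
   Context: A simple digraph (no loops, no multiple arcs; opposite arcs allowed) $T$ is semi-complete if for every pair of distinct vertices $v,w$ at least one of $(v,w)$, $(w,v)$ is an arc. A feedback arc set is a set $F\subseteq E(T)$ with $T\setminus F$ acyclic. A transitive tournament with ordering $(v_1,\ldots,v_n)$ has arc $(v_i,v_j)$ iff $i<j$. A $k$-cut of a digraph $T$ is a partition $(X,Y)$ of $V(T)$ such that at most $k$ arcs $(u,v)\in E(T)$ have $u\in Y$, $v\in X$. -}

module Defs where

open import Data.Nat using (ℕ; zero; suc; _+_; _≤_; _<_)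
open import Data.Fin using (Fin; toℕ)
open import Data.Bool using (Bool; true; false; T; _∧_; not; _≟_)
open import Data.List using (List; []; _∷_; map; allFin; length; filter)
open import Data.Nat.ListAction using (sum)
open import Data.Nat using (_<?_)
open import Data.Sum using (_⊎_)
open import Relation.Nullary.Decidable using (⌊_⌋)
open import Data.Product using (Σ; _×_; _,_; ∃)
open import Relation.Binary.PropositionalEquality using (_≡_; _≢_)
open import Relation.Nullary using (¬_)
open import Function.Bundles using (_↔_; Inverse)

Digraph : ℕ → Set
Digraph n = Fin n → Fin n → Bool

Arc : ∀ {n} → Digraph n → Fin n → Fin n → Set
Arc E u v = T (E u v)

-- simple digraph: no loops (multiple arcs are impossible in this encoding;
-- opposite arcs are allowed)
Loopless : ∀ {n} → Digraph n → Set
Loopless {n} E = (v : Fin n) → ¬ Arc E v v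

SemiComplete : ∀ {n} → Digraph n → Set
SemiComplete {n} E =
  Loopless E × ((u v : Fin n) → u ≢ v → Arc E u v ⊎ Arc E v u)

countPairs : ∀ {n} → (Fin n → Fin n → Bool) → ℕ
countPairs {n} P = sum (map (λ u → length (filter (λ v → P u v ≟ true) (allFin n))) (allFin n))

_⊆ᴬ_ : ∀ {n} → Digraph n → Digraph n → Set
_⊆ᴬ_ {n} F E = (u v : Fin n) → Arc F u v → Arc E u v

_∖ᴬ_ : ∀ {n} → Digraph n → Digraph n → Digraph n
(E ∖ᴬ F) u v = E u v ∧ not (F u v)

-- nonempty directed walks; a cycle is a closed one
data Path {n} (E : Digraph n) : Fin n → Fin n → Set where
  edge : ∀ {u v} → Arc E u v → Path E u v
  _∷ᴾ_ : ∀ {u v w} → Arc E u v → Path E v w → Path E u w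

Acyclic : ∀ {n} → Digraph n → Set
Acyclic {n} E = (v : Fin n) → ¬ Path E v v

FeedbackArcSet : ∀ {n} → Digraph n → Digraph n → Set
FeedbackArcSet E F = (F ⊆ᴬ E) × Acyclic (E ∖ᴬ F)

-- a vertex ordering: a bijection pos : V → {0,…,n-1}, v ↦ its position
Ordering : ℕ → Set
Ordering n = Fin n ↔ Fin n

IsTopologicalOrdering : ∀ {n} → Digraph n → Ordering n → Set
IsTopologicalOrdering {n} D σ =
  (u v : Fin n) → Arc D u v → toℕ (Inverse.to σ u) < toℕ (Inverse.to σ v)

transitiveTournament : ∀ {n} → Ordering n → Digraph n
transitiveTournament σ u v =
  ⌊ toℕ (Inverse.to σ u) <? toℕ (Inverse.to σ v) ⌋

-- a partition (X , Y) of V, encoded by the characteristic function of X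
-- (Y is the complement).  Number of backward arcs: u ∈ Y, v ∈ X.
backArcs : ∀ {n} → Digraph n → (Fin n → Bool) → ℕ
backArcs E X = countPairs (λ u v → E u v ∧ not (X u) ∧ X v)

IsCut : ∀ {n} → ℕ → Digraph n → (Fin n → Bool) → Set
IsCut k E X = backArcs E X ≤ k

-- Every arc (u , v) of T' with u ∈ Y, v ∈ X joins distinct vertices, so by semi-completeness
-- it is either an arc of T from Y to X, or T has the reverse arc (v , u).  In the latter case
-- (v , u) goes backwards in a topological ordering of T \ F, hence lies in F.  So T' has at
-- most (k arcs from Y to X in T) + (|F| ≤ k reversed arcs of F) = 2k arcs from Y to X.
module Submission where

open import Defs
open import Data.Nat using (ℕ; zero; suc; _≤_; _<_; _*_; _+_; z≤n; s≤s)
open import Data.Nat.Properties using (+-mono-≤; +-identityʳ; <-irrefl; <-asym; +-0-commutativeMonoid; module ≤-Reasoning)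
open import Data.Bool using (Bool; true; false; T; _∧_; not; _≟_)
open import Data.Bool.Properties using (T-∧; T-not-≡)
open import Data.Fin using (Fin; zero; suc; toℕ)
open import Data.List using (map; length; filter; tabulate)
open import Data.Nat.ListAction using (sum)
open import Data.Sum using (_⊎_; inj₁; inj₂)
open import Data.Product using (_,_)
open import Data.Empty using (⊥-elim)
open import Function using (id; flip; _∘_; Equivalence)
open import Function.Bundles using (Inverse)
open import Relation.Nullary.Decidable using (toWitness)
open import Relation.Binary.PropositionalEquality using (_≡_; _≢_; refl; cong; cong₂; trans; sym)
open import Algebra.Properties.CommutativeMonoid.Sum +-0-commutativeMonoid
  using (∑-comm; ∑-distrib-+; sum-cong-≗; sum-syntax) renaming (sum to ∑)

indicator : Bool → ℕ
indicator true  = 1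
indicator false = 0

indicator-≤-+ : ∀ {a b c} → (T a → T b ⊎ T c) → indicator a ≤ indicator b + indicator c
indicator-≤-+ {false}                _     = z≤n
indicator-≤-+ {true} {true}          _     = s≤s z≤n
indicator-≤-+ {true} {false} {true}  _     = s≤s z≤n
indicator-≤-+ {true} {false} {false} split with split _
... | inj₁ ()
... | inj₂ ()

∑-mono-≤ : ∀ {n} {f g : Fin n → ℕ} → (∀ i → f i ≤ g i) → ∑ f ≤ ∑ g
∑-mono-≤ {zero}  f≤g = z≤n
∑-mono-≤ {suc n} f≤g = +-mono-≤ (f≤g zero) (∑-mono-≤ (f≤g ∘ suc))

sum-map-tabulate : ∀ {A : Set} {n} (g : A → ℕ) (f : Fin n → A) →
  sum (map g (tabulate f)) ≡ ∑[ i < n ] g (f i)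
sum-map-tabulate {n = zero}  g f = refl
sum-map-tabulate {n = suc n} g f = cong (g (f zero) +_) (sum-map-tabulate g (f ∘ suc))

length-filter-tabulate : ∀ {A : Set} {n} (b : A → Bool) (f : Fin n → A) →
  length (filter (λ x → b x ≟ true) (tabulate f)) ≡ ∑[ i < n ] indicator (b (f i))
length-filter-tabulate {n = zero}  b f = refl
length-filter-tabulate {n = suc n} b f with b (f zero)
... | true  = cong suc (length-filter-tabulate b (f ∘ suc))
... | false = length-filter-tabulate b (f ∘ suc)

countPairs≡∑∑ : ∀ {n} (P : Fin n → Fin n → Bool) →
  countPairs P ≡ ∑[ u < n ] ∑[ v < n ] indicator (P u v)
countPairs≡∑∑ {n} P = trans
  (sum-map-tabulate (λ u → length (filter (λ v → P u v ≟ true) (tabulate id))) id)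
  (sum-cong-≗ (λ u → length-filter-tabulate (P u) id))

countPairs-flip : ∀ {n} (P : Fin n → Fin n → Bool) → countPairs (flip P) ≡ countPairs P
countPairs-flip P = trans (countPairs≡∑∑ (flip P))
  (trans (∑-comm (λ u v → indicator (P v u))) (sym (countPairs≡∑∑ P)))

countPairs-≤-+ : ∀ {n} {P Q R : Fin n → Fin n → Bool} →
  (∀ u v → T (P u v) → T (Q u v) ⊎ T (R u v)) →
  countPairs P ≤ countPairs Q + countPairs R
countPairs-≤-+ {n} {P} {Q} {R} split = begin
  countPairs P
    ≡⟨ countPairs≡∑∑ P ⟩
  ∑[ u < n ] ∑[ v < n ] indicator (P u v)
    ≤⟨ ∑-mono-≤ (λ u → ∑-mono-≤ (λ v → indicator-≤-+ (split u v))) ⟩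
  ∑[ u < n ] ∑[ v < n ] (indicator (Q u v) + indicator (R u v))
    ≡⟨ sum-cong-≗ (λ u → ∑-distrib-+ (λ v → indicator (Q u v)) (λ v → indicator (R u v))) ⟩
  ∑[ u < n ] (∑[ v < n ] indicator (Q u v) + ∑[ v < n ] indicator (R u v))
    ≡⟨ ∑-distrib-+ (λ u → ∑[ v < n ] indicator (Q u v)) (λ u → ∑[ v < n ] indicator (R u v)) ⟩
  ∑[ u < n ] ∑[ v < n ] indicator (Q u v) + ∑[ u < n ] ∑[ v < n ] indicator (R u v)
    ≡⟨ sym (cong₂ _+_ (countPairs≡∑∑ Q) (countPairs≡∑∑ R)) ⟩
  countPairs Q + countPairs R ∎
  where open ≤-Reasoning

position : ∀ {n} → Ordering n → Fin n → ℕ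
position σ v = toℕ (Inverse.to σ v)

backwardArc⇒feedbackArc : ∀ {n} {E F : Digraph n} {σ : Ordering n} →
  IsTopologicalOrdering (E ∖ᴬ F) σ →
  ∀ {u v} → Arc E v u → position σ u < position σ v → Arc F v u
backwardArc⇒feedbackArc {F = F} topological {u} {v} vu u<v with F v u in vu∉F
... | true  = _
... | false = ⊥-elim (<-asym u<v (topological v u
                (Equivalence.from T-∧ (vu , Equivalence.from T-not-≡ vu∉F))))

transitiveTournamentArc⇒arc⊎reversedFeedbackArc : ∀ {n} {E F : Digraph n} {σ : Ordering n} →
  ((u v : Fin n) → u ≢ v → Arc E u v ⊎ Arc E v u) →
  IsTopologicalOrdering (E ∖ᴬ F) σ →
  ∀ u v → Arc (transitiveTournament σ) u v → Arc E u v ⊎ Arc F v u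
transitiveTournamentArc⇒arc⊎reversedFeedbackArc {E = E} {F} {σ} semiComplete topological u v uv
  with semiComplete u v (λ { refl → <-irrefl refl (toWitness uv) })
... | inj₁ uv∈E = inj₁ uv∈E
... | inj₂ vu∈E = inj₂ (backwardArc⇒feedbackArc {E = E} {F} {σ} topological vu∈E (toWitness uv))

lemma3p5 : (n k : ℕ) (E F : Digraph n) → SemiComplete E
    → FeedbackArcSet E F → countPairs F ≤ k
    → (σ : Ordering n) → IsTopologicalOrdering (E ∖ᴬ F) σ
    → (X : Fin n → Bool) → IsCut k E X
    → IsCut (2 * k) (transitiveTournament σ) X
lemma3p5 n k E F (_ , semiComplete) _ |F|≤k σ topological X cut = begin
  backArcs (transitiveTournament σ) X
    ≤⟨ countPairs-≤-+ backArc-split ⟩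
  backArcs E X + countPairs (flip F)
    ≡⟨ cong (backArcs E X +_) (countPairs-flip F) ⟩
  backArcs E X + countPairs F
    ≤⟨ +-mono-≤ cut |F|≤k ⟩
  k + k
    ≡⟨ cong (k +_) (sym (+-identityʳ k)) ⟩
  2 * k ∎
  where
  open ≤-Reasoning
  backArc-split : ∀ u v → T (transitiveTournament σ u v ∧ not (X u) ∧ X v) →
    T (E u v ∧ not (X u) ∧ X v) ⊎ T (F v u)
  backArc-split u v back with Equivalence.to T-∧ back
  ... | uv , YX with transitiveTournamentArc⇒arc⊎reversedFeedbackArc {E = E} {F} {σ} semiComplete topological u v uv
  ...   | inj₁ uv∈E = inj₁ (Equivalence.from T-∧ (uv∈E , YX))
  ...   | inj₂ vu∈F = inj₂ vu∈F
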